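{- Let $q=2$, $d\leq e$ positive integers, $0\leq i\leq d-1$, $1\leq j\leq d$, $h=\min\{j,d-i\}$ and $h'=\min\{j,d-i-1\}$. Let $T_t(i,j)=(-1)^{j-t}2^{et+\binom{j-t}{2}}{d-t \brack d-j}_2{d-i \brack t}_2$. Then $\frac{|T_h(i,j)|}{|T_{h'}(i+1,j)|}>l$, where (i) $l=3$ if $d-i<j$ and $e\geq d+1$; (ii) $l=3/2$ if $d-i>j$ and $e\geq d+1$; (iii) $l=2$ if $d-i=j$ and $e\geq d+2$; (iv) $l=2^j$ if $d-i=j$ and $e=d+1$.
   Context: For integers $N\geq 0$ and $k$, ${N \brack k}_2=\prod_{t=1}^{k}\frac{2^{N-k+t}-1}{2^t-1}$ if $0\leq k\leq N$, and $0$ if $k<0$ or $k>N$. -}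

module Defs where

open import Data.Nat using (ℕ; zero; suc; _+_; _*_; _∸_; _^_; _≤_; _<_; _≤?_; NonZero; >-nonZero)
open import Data.Nat.Properties using (m*n≢0; m<n⇒0<n∸m; ≤-<-trans; m^n>0; *-monoʳ-≤)
open import Data.Nat.DivMod using (_/_)
open import Data.Nat.Combinatorics using (_C_)
open import Data.Integer using (ℤ; +_; -1ℤ) renaming (_*_ to _*ℤ_; _^_ to _^ℤ_)
open import Relation.Nullary using (yes; no)

prod1 : (ℕ → ℕ) → ℕ → ℕ
prod1 f zero = 1
prod1 f (suc k) = prod1 f k * f (suc k)

gdenom : ℕ → ℕ
gdenom k = prod1 (λ t → 2 ^ t ∸ 1) k

private
  1<2^suc : ∀ t → 1 < 2 ^ suc t
  1<2^suc t = *-monoʳ-≤ 2 (m^n>0 2 t)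

gdenom-nz : ∀ k → NonZero (gdenom k)
gdenom-nz zero = _
gdenom-nz (suc k) = m*n≢0 (gdenom k) (2 ^ suc k ∸ 1) {{gdenom-nz k}} {{>-nonZero (m<n⇒0<n∸m (1<2^suc k))}}

-- Gaussian binomial coefficient [N k]_2 = ∏_{t=1}^{k} (2^{N-k+t} - 1)/(2^t - 1) for 0 ≤ k ≤ N, 0 otherwise.
-- (The quotient is exact; computed with natural-number division.)
gauss2 : ℕ → ℕ → ℕ
gauss2 N k with k ≤? N
... | yes _ = _/_ (prod1 (λ t → 2 ^ (N ∸ k + t) ∸ 1) k) (gdenom k) {{gdenom-nz k}}
... | no _ = 0

-- T_t(i,j) = (-1)^{j-t} 2^{e t + binom(j-t,2)} [d-t, d-j]_2 [d-i, t]_2   (used only with t ≤ j ≤ d, i ≤ d)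
T : (d e i j t : ℕ) → ℤ
T d e i j t = (-1ℤ ^ℤ (j ∸ t)) *ℤ (+ (2 ^ (e * t + (j ∸ t) C 2) * gauss2 (d ∸ t) (d ∸ j) * gauss2 (d ∸ i) t))

private
  open import Relation.Binary.PropositionalEquality using (_≡_; refl)
  _ : gauss2 4 2 ≡ 35
  _ = refl
  _ : gauss2 5 0 ≡ 1
  _ = refl
  _ : gauss2 3 4 ≡ 0
  _ = refl
  _ : gauss2 5 3 ≡ 155
  _ = refl

-- Write n = d - i.  Both |T_h(i, j)| and |T_h'(i + 1, j)| are a power of 2 times two Gaussian
-- binomials, and by the rule [N + 1, k]_2 (2^(N + 1 - k) - 1) = [N, k]_2 (2^(N + 1) - 1) their
-- quotient is a power of 2 times a ratio of Mersenne numbers.  For n ≤ j, with c = j - n, it is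
-- 2^(e - c) (2^(c + 1) - 1) / (2^(d - n + 1) - 1): above 3 when c ≥ 1 and e > d, and above
-- 2^(e - d + j - 1) when c = 0.  For n > j it is (2^n - 1) / (2^(n - j) - 1) > 2.

module Submission where

open import Defs
open import Data.Nat using (ℕ; _≤_; _<_; _∸_; _^_; _⊓_; _+_; NonZero)
open import Data.Integer using (+_; ∣_∣)
open import Data.Rational using (ℚ; _/_) renaming (_<_ to _<ℚ_)
open import Data.Product using (Σ; _×_)
open import Relation.Binary.PropositionalEquality using (_≡_)

open import Data.Nat using (zero; suc; _*_; s≤s; z<s; _≤?_; >-nonZero)
open import Data.Nat.Properties
open import Data.Nat.Combinatorics using (_C_; nC1≡n; nCk+nC[k+1]≡[n+1]C[k+1])
open import Data.Nat.DivMod using (m*n/n≡m)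
open import Data.Nat.Solver using (module +-*-Solver)
open import Data.Integer using (-1ℤ; +<+) renaming (_<_ to _<ℤ_; _^_ to _^ℤ_)
open import Data.Integer.Properties using (abs-*; pos-*)
open import Data.Rational.Properties using (toℚᵘ-cancel-<; toℚᵘ-fromℚᵘ)
open import Data.Rational.Unnormalised using (mkℚᵘ; *<*)
open import Data.Rational.Unnormalised.Properties using (<-respˡ-≃; <-respʳ-≃; ≃-sym)
open import Data.Product using (_,_)
open import Relation.Binary.PropositionalEquality using (refl; sym; trans; cong; cong₂; subst; subst₂; module ≡-Reasoning)
open import Relation.Nullary using (yes; no; contradiction)
open +-*-Solver

∸-split : ∀ {n j d} → n ≤ j → j ≤ d → d ∸ n ≡ (j ∸ n) + (d ∸ j)
∸-split {n} {j} {d} n≤j j≤d = begin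
  d ∸ n                 ≡⟨ cong (_∸ n) (m∸n+n≡m j≤d) ⟨
  (d ∸ j) + j ∸ n       ≡⟨ +-∸-assoc (d ∸ j) n≤j ⟩
  (d ∸ j) + (j ∸ n)     ≡⟨ +-comm (d ∸ j) (j ∸ n) ⟩
  (j ∸ n) + (d ∸ j)     ∎
  where open ≡-Reasoning

mersenne : ℕ → ℕ
mersenne n = 2 ^ n ∸ 1

suc-mersenne : ∀ n → suc (mersenne n) ≡ 2 ^ n
suc-mersenne n = trans (+-comm 1 (mersenne n)) (m∸n+n≡m (m^n>0 2 n))

mersenne-+ : ∀ m n → mersenne (m + n) ≡ mersenne m + 2 ^ m * mersenne n
mersenne-+ m n = suc-injective (begin
  suc (mersenne (m + n))                ≡⟨ suc-mersenne (m + n) ⟩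
  2 ^ (m + n)                           ≡⟨ ^-distribˡ-+-* 2 m n ⟩
  2 ^ m * 2 ^ n                         ≡⟨ cong (2 ^ m *_) (sym (suc-mersenne n)) ⟩
  2 ^ m * suc (mersenne n)              ≡⟨ *-suc (2 ^ m) (mersenne n) ⟩
  2 ^ m + 2 ^ m * mersenne n            ≡⟨ cong (_+ 2 ^ m * mersenne n) (sym (suc-mersenne m)) ⟩
  suc (mersenne m) + 2 ^ m * mersenne n ∎)
  where open ≡-Reasoning

mersenne-suc : ∀ n → mersenne (suc n) ≡ suc (2 * mersenne n)
mersenne-suc = mersenne-+ 1

mersenne-pos : ∀ n → 0 < mersenne (suc n)
mersenne-pos n = subst (0 <_) (sym (mersenne-suc n)) z<s

mersenne-mono-≤ : ∀ {m n} → m ≤ n → mersenne m ≤ mersenne n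
mersenne-mono-≤ m≤n = ∸-monoˡ-≤ 1 (^-monoʳ-≤ 2 m≤n)

2^*mersenne<2^+ : ∀ m n → 2 ^ m * mersenne n < 2 ^ (m + n)
2^*mersenne<2^+ m n = begin-strict
  2 ^ m * mersenne n                    <⟨ s≤s (m≤n+m _ (mersenne m)) ⟩
  suc (mersenne m + 2 ^ m * mersenne n) ≡⟨ cong suc (mersenne-+ m n) ⟨
  suc (mersenne (m + n))                ≡⟨ suc-mersenne (m + n) ⟩
  2 ^ (m + n)                           ∎
  where open ≤-Reasoning

3*2^≤2*mersenne : ∀ c → 3 * 2 ^ suc c ≤ 2 * mersenne (suc (suc c))
3*2^≤2*mersenne c = begin
  3 * 2 ^ suc c                ≡⟨ cong (3 *_) (suc-mersenne (suc c)) ⟨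
  3 * suc x                    ≤⟨ bound (mersenne-pos c) ⟩
  2 * suc (2 * x)              ≡⟨ cong (2 *_) (mersenne-suc (suc c)) ⟨
  2 * mersenne (suc (suc c))   ∎
  where
  open ≤-Reasoning
  x = mersenne (suc c)
  bound : ∀ {y} → 0 < y → 3 * suc y ≤ 2 * suc (2 * y)
  bound {suc y} _ = subst (3 * suc (suc y) ≤_)
    (solve 1 (λ y → con 3 :* (con 2 :+ y) :+ y := con 2 :* (con 1 :+ con 2 :* (con 1 :+ y))) refl y)
    (m≤m+n _ y)

3*mersenne<2*mersenne : ∀ {m n} → m < n → 3 * mersenne m < mersenne n * 2
3*mersenne<2*mersenne {m} {n} m<n = begin-strict
  3 * x               <⟨ s≤s (m≤m+n (3 * x) (suc x)) ⟩
  suc (3 * x + suc x) ≡⟨ solve 1 (λ x → con 1 :+ (con 3 :* x :+ (con 1 :+ x)) := con 2 :* (con 1 :+ con 2 :* x)) refl x ⟩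
  2 * suc (2 * x)     ≡⟨ cong (2 *_) (mersenne-suc m) ⟨
  2 * mersenne (suc m) ≤⟨ *-monoʳ-≤ 2 (mersenne-mono-≤ m<n) ⟩
  2 * mersenne n      ≡⟨ *-comm 2 (mersenne n) ⟩
  mersenne n * 2      ∎
  where
  open ≤-Reasoning
  x = mersenne m

3*2^*mersenne<2^*mersenne : ∀ {c N e} → 1 ≤ c → 2 + N ≤ e →
  3 * (2 ^ c * mersenne (suc N)) < 2 ^ e * mersenne (suc c)
3*2^*mersenne<2^*mersenne {suc c} {N} {e} _ 2+N≤e = begin-strict
  3 * (2 ^ suc c * y) ≡⟨ *-assoc 3 (2 ^ suc c) y ⟨
  3 * 2 ^ suc c * y   ≤⟨ *-monoˡ-≤ y (3*2^≤2*mersenne c) ⟩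
  2 * z * y           ≡⟨ solve 2 (λ z y → con 2 :* z :* y := z :* (con 2 :* y)) refl z y ⟩
  z * (2 * y)         <⟨ *-monoʳ-< z {{>-nonZero (mersenne-pos (suc c))}} (2^*mersenne<2^+ 1 (suc N)) ⟩
  z * 2 ^ (2 + N)     ≤⟨ *-monoʳ-≤ z (^-monoʳ-≤ 2 2+N≤e) ⟩
  z * 2 ^ e           ≡⟨ *-comm z (2 ^ e) ⟩
  2 ^ e * z           ∎
  where
  open ≤-Reasoning
  y = mersenne (suc N)
  z = mersenne (suc (suc c))

2^-pascal : ∀ e m c → 2 ^ (e * suc m + c C 2) * 2 ^ c ≡ 2 ^ e * 2 ^ (e * m + suc c C 2)
2^-pascal e m c = begin
  2 ^ (e * suc m + c C 2) * 2 ^ c ≡⟨ ^-distribˡ-+-* 2 (e * suc m + c C 2) c ⟨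
  2 ^ (e * suc m + c C 2 + c)     ≡⟨ cong (2 ^_) exponent ⟩
  2 ^ (e + (e * m + suc c C 2))   ≡⟨ ^-distribˡ-+-* 2 e (e * m + suc c C 2) ⟩
  2 ^ e * 2 ^ (e * m + suc c C 2) ∎
  where
  open ≡-Reasoning
  exponent : e * suc m + c C 2 + c ≡ e + (e * m + suc c C 2)
  exponent = begin
    e * suc m + c C 2 + c        ≡⟨ cong (λ x → x + c C 2 + c) (*-suc e m) ⟩
    e + e * m + c C 2 + c        ≡⟨ solve 4 (λ e f b c → e :+ f :+ b :+ c := e :+ (f :+ (c :+ b))) refl e (e * m) (c C 2) c ⟩
    e + (e * m + (c + c C 2))    ≡⟨ cong (λ x → e + (e * m + (x + c C 2))) (nC1≡n c) ⟨
    e + (e * m + (c C 1 + c C 2)) ≡⟨ cong (λ x → e + (e * m + x)) (nCk+nC[k+1]≡[n+1]C[k+1] c 1) ⟩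
    e + (e * m + suc c C 2)      ∎

/-<-cross : ∀ p q A B .{{_ : NonZero q}} .{{_ : NonZero B}} → p * B < A * q → (+ p / q) <ℚ (+ A / B)
/-<-cross p (suc q) A (suc B) p*B<A*q = toℚᵘ-cancel-<
  (<-respˡ-≃ (≃-sym (toℚᵘ-fromℚᵘ (mkℚᵘ (+ p) q)))
  (<-respʳ-≃ (≃-sym (toℚᵘ-fromℚᵘ (mkℚᵘ (+ A) B)))
  (*<* (subst₂ _<ℤ_ (pos-* p (suc B)) (pos-* A (suc q)) (+<+ p*B<A*q)))))

ratio-< : ∀ {u v} A B p q .{{_ : NonZero q}} .{{_ : NonZero B}} →
  A * u ≡ B * v → p * u < v * q → (+ p / q) <ℚ (+ A / B)
ratio-< {u} {v} A B p q A*u≡B*v p*u<v*q = /-<-cross p q A B (*-cancelʳ-< u (p * B) (A * q) (begin-strict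
  p * B * u   ≡⟨ solve 3 (λ p b u → p :* b :* u := b :* (p :* u)) refl p B u ⟩
  B * (p * u) <⟨ *-monoʳ-< B p*u<v*q ⟩
  B * (v * q) ≡⟨ *-assoc B v q ⟨
  B * v * q   ≡⟨ cong (_* q) A*u≡B*v ⟨
  A * u * q   ≡⟨ solve 3 (λ a u q → a :* u :* q := a :* q :* u) refl A u q ⟩
  A * q * u   ∎))
  where open ≤-Reasoning

ratio-<₁ : ∀ {u v} A B p .{{_ : NonZero B}} → A * u ≡ B * v → p * u < v → (+ p / 1) <ℚ (+ A / B)
ratio-<₁ {v = v} A B p A*u≡B*v p*u<v = ratio-< A B p 1 A*u≡B*v (subst (p * _ <_) (sym (*-identityʳ v)) p*u<v)

-- qbinom a k = [a + k, k]_2, computed by the q-Pascal rule [n, k] = [n - 1, k - 1] + 2^k [n - 1, k].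
qbinom : ℕ → ℕ → ℕ
qbinom zero    k       = 1
qbinom (suc a) zero    = 1
qbinom (suc a) (suc k) = qbinom (suc a) k + 2 ^ suc k * qbinom a (suc k)

qbinom-pos : ∀ a k → 0 < qbinom a k
qbinom-pos zero    k       = z<s
qbinom-pos (suc a) zero    = z<s
qbinom-pos (suc a) (suc k) = <-≤-trans (qbinom-pos (suc a) k) (m≤m+n _ _)

-- the numerator of gauss2 (a + k) k
gnum : ℕ → ℕ → ℕ
gnum a k = prod1 (λ t → mersenne (a + t)) k

gnum-suc : ∀ a k → gnum a (suc k) ≡ mersenne (suc a) * gnum (suc a) k
gnum-suc a zero    = trans (*-identityˡ _) (trans (cong mersenne (+-comm a 1)) (sym (*-identityʳ _)))
gnum-suc a (suc k) = begin
  gnum a (suc k) * mersenne (a + suc (suc k))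
    ≡⟨ cong₂ _*_ (gnum-suc a k) (cong mersenne (+-suc a (suc k))) ⟩
  mersenne (suc a) * gnum (suc a) k * mersenne (suc a + suc k)
    ≡⟨ *-assoc (mersenne (suc a)) _ _ ⟩
  mersenne (suc a) * gnum (suc a) (suc k) ∎
  where open ≡-Reasoning

qbinom*gdenom≡gnum : ∀ a k → qbinom a k * gdenom k ≡ gnum a k
qbinom*gdenom≡gnum zero    k       = +-identityʳ _
qbinom*gdenom≡gnum (suc a) zero    = refl
qbinom*gdenom≡gnum (suc a) (suc k) = begin
  (qbinom (suc a) k + 2 ^ suc k * qbinom a (suc k)) * (gdenom k * mersenne (suc k))
    ≡⟨ solve 5 (λ q x p q' D → (q :+ p :* q') :* (D :* x) := (q :* D) :* x :+ p :* (q' :* (D :* x)))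
             refl (qbinom (suc a) k) (mersenne (suc k)) (2 ^ suc k) (qbinom a (suc k)) (gdenom k) ⟩
  qbinom (suc a) k * gdenom k * mersenne (suc k) + 2 ^ suc k * (qbinom a (suc k) * gdenom (suc k))
    ≡⟨ cong₂ (λ u v → u * mersenne (suc k) + 2 ^ suc k * v) (qbinom*gdenom≡gnum (suc a) k)
             (trans (qbinom*gdenom≡gnum a (suc k)) (gnum-suc a k)) ⟩
  R * mersenne (suc k) + 2 ^ suc k * (mersenne (suc a) * R)
    ≡⟨ solve 4 (λ r x p y → r :* x :+ p :* (y :* r) := r :* (x :+ p :* y))
             refl R (mersenne (suc k)) (2 ^ suc k) (mersenne (suc a)) ⟩
  R * (mersenne (suc k) + 2 ^ suc k * mersenne (suc a))
    ≡⟨ cong (R *_) (trans (sym (mersenne-+ (suc k) (suc a))) (cong mersenne (+-comm (suc k) (suc a)))) ⟩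
  gnum (suc a) (suc k) ∎
  where
  open ≡-Reasoning
  R = gnum (suc a) k

gauss2-qbinom : ∀ a k → gauss2 (a + k) k ≡ qbinom a k
gauss2-qbinom a k with k ≤? a + k
... | yes _ rewrite m+n∸n≡m a k | sym (qbinom*gdenom≡gnum a k) =
  m*n/n≡m (qbinom a k) (gdenom k) {{gdenom-nz k}}
... | no k≰a+k = contradiction (m≤n+m k a) k≰a+k

gauss2-diag : ∀ k → gauss2 k k ≡ 1
gauss2-diag = gauss2-qbinom 0

gauss2-nonZero : ∀ {N k} → k ≤ N → NonZero (gauss2 N k)
gauss2-nonZero {N} {k} k≤N = subst (λ n → NonZero (gauss2 n k)) (m∸n+n≡m k≤N)
  (>-nonZero (subst (0 <_) (sym (gauss2-qbinom (N ∸ k) k)) (qbinom-pos (N ∸ k) k)))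

gauss2-step : ∀ a k → gauss2 (a + k) k * mersenne (suc a + k) ≡ mersenne (suc a) * gauss2 (suc a + k) k
gauss2-step a k rewrite gauss2-qbinom a k | gauss2-qbinom (suc a) k =
  *-cancelʳ-≡ _ _ (gdenom k) {{gdenom-nz k}} (begin
    qbinom a k * mersenne (suc a + k) * gdenom k
      ≡⟨ solve 3 (λ q x D → q :* x :* D := q :* D :* x) refl (qbinom a k) (mersenne (suc a + k)) (gdenom k) ⟩
    qbinom a k * gdenom k * mersenne (suc (a + k))
      ≡⟨ cong₂ _*_ (qbinom*gdenom≡gnum a k) (cong mersenne (sym (+-suc a k))) ⟩
    gnum a (suc k)
      ≡⟨ gnum-suc a k ⟩
    mersenne (suc a) * gnum (suc a) k
      ≡⟨ cong (mersenne (suc a) *_) (qbinom*gdenom≡gnum (suc a) k) ⟨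
    mersenne (suc a) * (qbinom (suc a) k * gdenom k)
      ≡⟨ *-assoc (mersenne (suc a)) _ _ ⟨
    mersenne (suc a) * qbinom (suc a) k * gdenom k ∎)
  where open ≡-Reasoning

∣-1^n∣≡1 : ∀ n → ∣ -1ℤ ^ℤ n ∣ ≡ 1
∣-1^n∣≡1 zero    = refl
∣-1^n∣≡1 (suc n) = trans (abs-* -1ℤ (-1ℤ ^ℤ n)) (cong (1 *_) (∣-1^n∣≡1 n))

Tabs : (d e n j t : ℕ) → ℕ
Tabs d e n j t = 2 ^ (e * t + (j ∸ t) C 2) * gauss2 (d ∸ t) (d ∸ j) * gauss2 n t

∣T∣≡Tabs : ∀ d e i j t → ∣ T d e i j t ∣ ≡ Tabs d e (d ∸ i) j t
∣T∣≡Tabs d e i j t = trans (abs-* (-1ℤ ^ℤ (j ∸ t)) _)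
  (trans (cong (_* Tabs d e (d ∸ i) j t) (∣-1^n∣≡1 (j ∸ t))) (*-identityˡ _))

-- |T_h(i, j)| with n = d - i and h = min(j, n); then |T_h'(i + 1, j)| = leadT d e (n ∸ 1) j.
leadT : (d e n j : ℕ) → ℕ
leadT d e n j = Tabs d e n j (j ⊓ n)

leadT-nonZero : ∀ {d j} e n → NonZero (leadT d e n j)
leadT-nonZero {d} {j} e n =
  m*n≢0 (2 ^ (e * h + (j ∸ h) C 2) * gauss2 (d ∸ h) (d ∸ j)) (gauss2 n h)
    {{m*n≢0 (2 ^ (e * h + (j ∸ h) C 2)) (gauss2 (d ∸ h) (d ∸ j))
      {{m^n≢0 2 (e * h + (j ∸ h) C 2)}} {{gauss2-nonZero (∸-monoʳ-≤ d (m⊓n≤m j n))}}}}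
    {{gauss2-nonZero (m⊓n≤n j n)}}
  where h = j ⊓ n

leadT-ratio-≤ : ∀ d e n j → 1 ≤ n → n ≤ j → j ≤ d →
  leadT d e n j * (2 ^ (j ∸ n) * mersenne (suc (d ∸ n)))
    ≡ leadT d e (n ∸ 1) j * (2 ^ e * mersenne (suc (j ∸ n)))
leadT-ratio-≤ d e (suc m) (suc j′) _ (s≤s m≤j′) j≤d with j′ ∸ m | m∸n+n≡m m≤j′
... | c | refl
  rewrite m≥n⇒m⊓n≡n (m≤n+m m c) | m≥n⇒m⊓n≡n (m≤n+m m (suc c))
        | ∸-split (s≤s (m≤n+m m c)) j≤d | ∸-split (m≤n+m m (suc c)) j≤d
        | m+n∸n≡m c m | m+n∸n≡m (suc c) m | gauss2-diag (suc m) | gauss2-diag m = begin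
  P * g * 1 * (2 ^ c * mersenne (suc c + K))
    ≡⟨ solve 4 (λ P g x M → P :* g :* con 1 :* (x :* M) := (P :* x) :* (g :* M))
             refl P g (2 ^ c) (mersenne (suc c + K)) ⟩
  (P * 2 ^ c) * (g * mersenne (suc c + K))
    ≡⟨ cong₂ _*_ (2^-pascal e m c) (gauss2-step c K) ⟩
  (2 ^ e * P′) * (mersenne (suc c) * g′)
    ≡⟨ solve 4 (λ x P g M → (x :* P) :* (M :* g) := P :* g :* con 1 :* (x :* M))
             refl (2 ^ e) P′ g′ (mersenne (suc c)) ⟩
  P′ * g′ * 1 * (2 ^ e * mersenne (suc c)) ∎
  where
  open ≡-Reasoning
  K = d ∸ suc (c + m)
  P = 2 ^ (e * suc m + c C 2)
  P′ = 2 ^ (e * m + suc c C 2)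
  g = gauss2 (c + K) K
  g′ = gauss2 (suc c + K) K

leadT-ratio-> : ∀ d e n j → j < n → leadT d e n j * mersenne (n ∸ j) ≡ leadT d e (n ∸ 1) j * mersenne n
leadT-ratio-> d e (suc n′) j (s≤s j≤n′) with n′ ∸ j | m∸n+n≡m j≤n′
... | b | refl
  rewrite m≤n⇒m⊓n≡m (m≤n+m j (suc b)) | m≤n⇒m⊓n≡m (m≤n+m j b) | m+n∸n≡m (suc b) j = begin
  P * g′ * mersenne (suc b)   ≡⟨ *-assoc P g′ _ ⟩
  P * (g′ * mersenne (suc b)) ≡⟨ cong (P *_) (*-comm g′ _) ⟩
  P * (mersenne (suc b) * g′) ≡⟨ cong (P *_) (gauss2-step b j) ⟨
  P * (g * mersenne (suc b + j)) ≡⟨ *-assoc P g _ ⟨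
  P * g * mersenne (suc b + j) ∎
  where
  open ≡-Reasoning
  P = 2 ^ (e * j + (j ∸ j) C 2) * gauss2 (d ∸ j) (d ∸ j)
  g = gauss2 (b + j) j
  g′ = gauss2 (suc b + j) j

leadT-ratio-≡ : ∀ d e n j → n ≡ j → 1 ≤ j → j ≤ d →
  leadT d e n j * mersenne (suc (d ∸ n)) ≡ leadT d e (n ∸ 1) j * 2 ^ e
leadT-ratio-≡ d e n .n refl 1≤n n≤d = begin
  A * M                                ≡⟨ cong (A *_) (*-identityˡ M) ⟨
  A * (1 * M)                          ≡⟨ cong (λ t → A * (2 ^ t * M)) (n∸n≡0 n) ⟨
  A * (2 ^ (n ∸ n) * M)                ≡⟨ leadT-ratio-≤ d e n n 1≤n ≤-refl n≤d ⟩
  B * (2 ^ e * mersenne (suc (n ∸ n))) ≡⟨ cong (λ t → B * (2 ^ e * mersenne (suc t))) (n∸n≡0 n) ⟩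
  B * (2 ^ e * 1)                      ≡⟨ cong (B *_) (*-identityʳ (2 ^ e)) ⟩
  B * 2 ^ e                            ∎
  where
  open ≡-Reasoning
  A = leadT d e n n
  B = leadT d e (n ∸ 1) n
  M = mersenne (suc (d ∸ n))

-- the conclusion of the theorem for A = |T_h(i, j)| and B = |T_h'(i + 1, j)|, where n = d - i
RatioBounds : (d e n j A B : ℕ) → Set
RatioBounds d e n j A B = Σ (NonZero B) λ nz →
  let ratio = _/_ (+ A) B {{nz}}
  in ((n < j → d + 1 ≤ e → (+ 3 / 1) <ℚ ratio)
    × (j < n → d + 1 ≤ e → (+ 3 / 2) <ℚ ratio)
    × (n ≡ j → d + 2 ≤ e → (+ 2 / 1) <ℚ ratio)
    × (n ≡ j → e ≡ d + 1 → (+ (2 ^ j) / 1) <ℚ ratio))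

leadT-ratioBounds : ∀ d e n j → 1 ≤ n → n ≤ d → 1 ≤ j → j ≤ d →
  RatioBounds d e n j (leadT d e n j) (leadT d e (n ∸ 1) j)
leadT-ratioBounds d e n j 1≤n n≤d 1≤j j≤d = leadT-nonZero e (n ∸ 1) , case-i , case-ii , case-iii , case-iv
  where
  instance _ = leadT-nonZero {d} {j} e (n ∸ 1)
  A = leadT d e n j
  B = leadT d e (n ∸ 1) j
  ratio = + A / B

  case-i : n < j → d + 1 ≤ e → (+ 3 / 1) <ℚ ratio
  case-i n<j d+1≤e = ratio-<₁ A B 3 (leadT-ratio-≤ d e n j 1≤n (<⇒≤ n<j) j≤d)
    (3*2^*mersenne<2^*mersenne (m<n⇒0<n∸m n<j) (≤-trans (s≤s d∸n<d) (subst (_≤ e) (+-comm d 1) d+1≤e)))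
    where
    d∸n<d : d ∸ n < d
    d∸n<d = ∸-monoʳ-< 1≤n n≤d

  case-ii : j < n → d + 1 ≤ e → (+ 3 / 2) <ℚ ratio
  case-ii j<n _ = ratio-< A B 3 2 (leadT-ratio-> d e n j j<n)
    (3*mersenne<2*mersenne (∸-monoʳ-< 1≤j (<⇒≤ j<n)))

  case-iii : n ≡ j → d + 2 ≤ e → (+ 2 / 1) <ℚ ratio
  case-iii n≡j d+2≤e = ratio-<₁ A B 2 (leadT-ratio-≡ d e n j n≡j 1≤j j≤d)
    (<-≤-trans (2^*mersenne<2^+ 1 (suc (d ∸ n)))
      (^-monoʳ-≤ 2 (≤-trans (+-monoʳ-≤ 2 (m∸n≤m d n)) (subst (_≤ e) (+-comm d 2) d+2≤e))))

  case-iv : n ≡ j → e ≡ d + 1 → (+ (2 ^ j) / 1) <ℚ ratio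
  case-iv n≡j e≡d+1 = ratio-<₁ A B (2 ^ j) (leadT-ratio-≡ d e n j n≡j 1≤j j≤d)
    (subst (2 ^ j * mersenne (suc (d ∸ n)) <_) (cong (2 ^_) (j+suc[d∸n]≡e n≡j))
      (2^*mersenne<2^+ j (suc (d ∸ n))))
    where
    j+suc[d∸n]≡e : n ≡ j → j + suc (d ∸ n) ≡ e
    j+suc[d∸n]≡e refl =
      trans (+-suc n (d ∸ n)) (trans (cong suc (m+[n∸m]≡n n≤d)) (trans (+-comm 1 d) (sym e≡d+1)))

lemma4p5 : (d e i j : ℕ) → 1 ≤ d → d ≤ e → i < d → 1 ≤ j → j ≤ d →
    Σ (NonZero ∣ T d e (i + 1) j (j ⊓ (d ∸ i ∸ 1)) ∣) λ nz →
      let ratio = _/_ (+ ∣ T d e i j (j ⊓ (d ∸ i)) ∣) ∣ T d e (i + 1) j (j ⊓ (d ∸ i ∸ 1)) ∣ {{nz}}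
      in ((d ∸ i < j → d + 1 ≤ e → (+ 3 / 1) <ℚ ratio)
        × (j < d ∸ i → d + 1 ≤ e → (+ 3 / 2) <ℚ ratio)
        × (d ∸ i ≡ j → d + 2 ≤ e → (+ 2 / 1) <ℚ ratio)
        × (d ∸ i ≡ j → e ≡ d + 1 → (+ (2 ^ j) / 1) <ℚ ratio))
lemma4p5 d e i j _ _ i<d 1≤j j≤d =
  subst₂ (RatioBounds d e (d ∸ i) j) (sym (∣T∣≡Tabs d e i j (j ⊓ (d ∸ i)))) (sym ∣T[i+1]∣≡leadT)
    (leadT-ratioBounds d e (d ∸ i) j (m<n⇒0<n∸m i<d) (m∸n≤m d i) 1≤j j≤d)
  where
  ∣T[i+1]∣≡leadT : ∣ T d e (i + 1) j (j ⊓ (d ∸ i ∸ 1)) ∣ ≡ leadT d e (d ∸ i ∸ 1) j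
  ∣T[i+1]∣≡leadT = trans (∣T∣≡Tabs d e (i + 1) j (j ⊓ (d ∸ i ∸ 1)))
    (cong (λ n → Tabs d e n j (j ⊓ (d ∸ i ∸ 1))) (sym (∸-+-assoc d i 1)))
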